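{- Let $m,n$ be positive integers with $m\ge 5$, $n\ge 8$, $n>m$, and let $j\in\{1,2\}$. Then $r(K_{1,m-1},T_n^j)=m+n-4$ or $r(K_{1,m-1},T_n^j)=m+n-5$. Moreover, if $2\mid mn$, then $r(K_{1,m-1},T_n^j)=m+n-4$.
   Context: All graphs are finite and simple. $K_{1,m-1}$ is the star on $m$ vertices. For graphs $G_1,G_2$, the Ramsey number $r(G_1,G_2)$ is the smallest positive integer $N$ such that for every graph $G$ on $N$ vertices, either $G$ contains a subgraph isomorphic to $G_1$ or the complement $\overline G$ contains a subgraph isomorphic to $G_2$. $T_n^1$ is the tree with vertex set $\{v_0,\ldots,v_{n-1}\}$ and edge set $\{v_0v_1,\ldots,v_0v_{n-3},v_{n-4}v_{n-2},v_{n-3}v_{n-1}\}$; $T_n^2$ is the tree with the same vertex set and edge set $\{v_0v_1,\ldots,v_0v_{n-3},v_{n-3}v_{n-2},v_{n-3}v_{n-1}\}$. -}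

module Defs where

open import Data.Nat using (ℕ; zero; suc; _+_; _∸_; _≤_; _<_)
open import Data.Fin using (Fin; toℕ)
open import Data.Bool using (Bool; true; false; not; _∧_; _∨_)
open import Data.Product using (Σ; _×_; _,_)
open import Data.Sum using (_⊎_)
open import Relation.Binary.PropositionalEquality using (_≡_; _≢_)
open import Relation.Nullary using (¬_)
open import Function.Definitions using (Injective)
open import Data.Nat using (_≡ᵇ_)

record Graph (n : ℕ) : Set where
  field
    adj   : Fin n → Fin n → Bool
    sym   : ∀ u v → adj u v ≡ adj v u
    irrefl : ∀ v → adj v v ≡ false
open Graph public

neqᵇ : ∀ {n} → Fin n → Fin n → Bool
neqᵇ u v = not (toℕ u ≡ᵇ toℕ v)

_⊆G_ : ∀ {k n} → (Fin k → Fin k → Bool) → (Fin n → Fin n → Bool) → Set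
_⊆G_ {k} {n} H G =
  Σ (Fin k → Fin n) λ f →
    Injective _≡_ _≡_ f × (∀ u v → H u v ≡ true → G (f u) (f v) ≡ true)

complAdj : ∀ {n} → Graph n → Fin n → Fin n → Bool
complAdj G u v = neqᵇ u v ∧ not (adj G u v)

Arrows : ∀ {k₁ k₂} → (Fin k₁ → Fin k₁ → Bool) → (Fin k₂ → Fin k₂ → Bool) → ℕ → Set
Arrows H₁ H₂ N = (G : Graph N) → (H₁ ⊆G adj G) ⊎ (H₂ ⊆G complAdj G)

RamseyNumber : ∀ {k₁ k₂} → (Fin k₁ → Fin k₁ → Bool) → (Fin k₂ → Fin k₂ → Bool) → ℕ → Set
RamseyNumber H₁ H₂ N =
  1 ≤ N × Arrows H₁ H₂ N × (∀ M → 1 ≤ M → M < N → ¬ Arrows H₁ H₂ M)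

edgeᵇ : ∀ {n} → ℕ → ℕ → Fin n → Fin n → Bool
edgeᵇ a b u v = ((toℕ u ≡ᵇ a) ∧ (toℕ v ≡ᵇ b)) ∨ ((toℕ u ≡ᵇ b) ∧ (toℕ v ≡ᵇ a))

star : (m : ℕ) → Fin m → Fin m → Bool
star m u v = ((toℕ u ≡ᵇ 0) ∧ neqᵇ u v) ∨ ((toℕ v ≡ᵇ 0) ∧ neqᵇ u v)

spokeᵇ : ∀ {n} → Fin n → Fin n → Bool
spokeᵇ {n} u v = ((toℕ u ≡ᵇ 0) ∧ inR (toℕ v)) ∨ ((toℕ v ≡ᵇ 0) ∧ inR (toℕ u))
  where
    inR : ℕ → Bool
    inR zero = false
    inR (suc i) = Data.Nat._≤ᵇ_ (suc i) (n ∸ 3)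

T1 : (n : ℕ) → Fin n → Fin n → Bool
T1 n u v = spokeᵇ u v ∨ edgeᵇ (n ∸ 4) (n ∸ 2) u v ∨ edgeᵇ (n ∸ 3) (n ∸ 1) u v

T2 : (n : ℕ) → Fin n → Fin n → Bool
T2 n u v = spokeᵇ u v ∨ edgeᵇ (n ∸ 3) (n ∸ 2) u v ∨ edgeᵇ (n ∸ 3) (n ∸ 1) u v

Tree : (j : Fin 2) → (n : ℕ) → Fin n → Fin n → Bool
Tree Fin.zero n = T1 n
Tree (Fin.suc Fin.zero) n = T2 n

module Submission where

-- If G on m+n-4 vertices has no
-- K_{1,m-1}, every vertex has at most m-2 neighbours, so its complement H has
-- minimum degree ≥ n-3.  A vertex of H-degree ≥ n-2 carries a path c–y–a that
-- leaves enough neighbours of c to finish either tree; otherwise H is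
-- (n-3)-regular and we study the edges between the neighbours and the
-- non-neighbours of one vertex c ("forks" for T_n^2, "matchings" for T_n^1).  A graph of maximum degree ≤ m-2
-- whose complement has maximum degree ≤ n-4 does not arrow, since the centres of
-- K_{1,m-1} and T_n^j have degrees m-1 and n-3: the empty graph below n vertices,
-- a circulant of even degree 2k ∈ {m-3, m-2} up to m+n-6 vertices, and at m+n-5
-- vertices a circulant of degree m-2 (m even) or the complement of one of degree
-- n-4 (n even).  Arrowing is decidable by exhaustive search (arrows?), so either
-- m+n-5 vertices arrow (r = m+n-5) or they do not (r = m+n-4).

open import Defs hiding (sym)
open import Data.Nat using (ℕ; zero; suc; _+_; _∸_; _*_; _≤_; _<_; z≤n; s≤s; _≡ᵇ_; _≤ᵇ_; _≤?_; _<?_; pred)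
open import Data.Nat.Properties
open import Data.Nat.Divisibility using (_∣_; divides)
open import Data.Nat.Tactic.RingSolver using (solve-∀)
open import Data.Fin using (Fin; zero; suc; toℕ; fromℕ<; inject≤)
open import Data.Fin.Properties using (toℕ-injective; toℕ<n; toℕ-fromℕ<; toℕ-inject≤; inject≤-injective; any?; all?) renaming (suc-injective to fsuc-injective; _≟_ to _≟F_)
open import Data.Bool using (Bool; true; false; not; _∧_; _∨_; T)
open import Data.Bool.Properties using (∧-identityʳ; ∧-zeroʳ; ∧-comm; ∨-comm) renaming (_≟_ to _≟B_)
open import Data.Product using (Σ; ∃; _×_; _,_; proj₁; proj₂)
open import Data.Sum using (_⊎_; inj₁; inj₂; [_,_])
open import Data.Empty using (⊥; ⊥-elim)
open import Function using (_∘_)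
open import Function.Definitions using (Injective)
open import Relation.Binary.PropositionalEquality hiding ([_])
open import Relation.Nullary using (¬_; Dec; yes; no; _×-dec_; _⊎-dec_; _→-dec_; ¬?)

∧-elimˡ : ∀ {a b} → a ∧ b ≡ true → a ≡ true
∧-elimˡ {true} _ = refl

∧-elimʳ : ∀ {a b} → a ∧ b ≡ true → b ≡ true
∧-elimʳ {true} e = e

∧-intro : ∀ {a b} → a ≡ true → b ≡ true → a ∧ b ≡ true
∧-intro refl refl = refl

∨-elim : ∀ {a b} → a ∨ b ≡ true → a ≡ true ⊎ b ≡ true
∨-elim {true} _ = inj₁ refl
∨-elim {false} e = inj₂ e

not-elim : ∀ {a} → not a ≡ true → a ≡ false
not-elim {false} _ = refl

not-intro : ∀ {a} → a ≡ false → not a ≡ true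
not-intro refl = refl

true≢false : ∀ {a} → a ≡ true → a ≡ false → ⊥
true≢false refl ()

≡ᵇ-elim : ∀ {a b} → (a ≡ᵇ b) ≡ true → a ≡ b
≡ᵇ-elim {a} {b} e = ≡ᵇ⇒≡ a b (subst T (sym e) _)

≡ᵇ-refl : ∀ n → (n ≡ᵇ n) ≡ true
≡ᵇ-refl zero = refl
≡ᵇ-refl (suc n) = ≡ᵇ-refl n

≡ᵇ-sym : ∀ m n → (m ≡ᵇ n) ≡ (n ≡ᵇ m)
≡ᵇ-sym zero zero = refl
≡ᵇ-sym zero (suc n) = refl
≡ᵇ-sym (suc m) zero = refl
≡ᵇ-sym (suc m) (suc n) = ≡ᵇ-sym m n

≤ᵇ-elim : ∀ a b → (a ≤ᵇ b) ≡ true → a ≤ b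
≤ᵇ-elim a b e = ≤ᵇ⇒≤ a b (subst T (sym e) _)

≤ᵇ-intro : ∀ {a b} → a ≤ b → (a ≤ᵇ b) ≡ true
≤ᵇ-intro {a} {b} le with a ≤ᵇ b in e
... | true = refl
... | false = ⊥-elim (subst T e (≤⇒≤ᵇ le))

≤ᵇ-false : ∀ a b → (a ≤ᵇ b) ≡ false → b < a
≤ᵇ-false a b e = ≰⇒> (λ a≤b → true≢false (≤ᵇ-intro a≤b) e)

∨-falseˡ : ∀ {a b} → a ∨ b ≡ false → a ≡ false
∨-falseˡ {false} _ = refl

∨-falseʳ : ∀ {a b} → a ∨ b ≡ false → b ≡ false
∨-falseʳ {false} e = e

neqᵇ-self : ∀ {N} (x : Fin N) → neqᵇ x x ≡ false
neqᵇ-self x = cong not (≡ᵇ-refl (toℕ x))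

neqᵇ-sym : ∀ {N} (x y : Fin N) → neqᵇ x y ≡ neqᵇ y x
neqᵇ-sym x y = cong not (≡ᵇ-sym (toℕ x) (toℕ y))

neqᵇ-≢ : ∀ {N} {x y : Fin N} → neqᵇ x y ≡ true → x ≢ y
neqᵇ-≢ {x = x} e refl = true≢false e (neqᵇ-self x)

≢-neqᵇ : ∀ {N} {x y : Fin N} → x ≢ y → neqᵇ x y ≡ true
≢-neqᵇ {x = x} {y} x≢y with toℕ x ≡ᵇ toℕ y in e
... | true = ⊥-elim (x≢y (toℕ-injective (≡ᵇ-elim e)))
... | false = refl

indicator : Bool → ℕ
indicator true = 1
indicator false = 0

indicator≤1 : ∀ b → indicator b ≤ 1
indicator≤1 true = ≤-refl
indicator≤1 false = z≤n

count : ∀ {N} → (Fin N → Bool) → ℕ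
count {zero} P = 0
count {suc N} P = indicator (P zero) + count (P ∘ suc)

-- They are opaque:
-- everything below uses only their membership and counting lemmas, which keeps
-- the predicates recognisable to unification.
opaque
  _∩_ : ∀ {N} → (Fin N → Bool) → (Fin N → Bool) → Fin N → Bool
  (P ∩ Q) x = P x ∧ Q x

  _∖_ : ∀ {N} → (Fin N → Bool) → (Fin N → Bool) → Fin N → Bool
  (P ∖ Q) x = P x ∧ not (Q x)

  _─_ : ∀ {N} → (Fin N → Bool) → Fin N → Fin N → Bool
  (P ─ x) y = P y ∧ neqᵇ x y

infixl 7 _∩_ _∖_
infixl 6 _─_

count-cong : ∀ {N} {P Q : Fin N → Bool} → (∀ x → P x ≡ Q x) → count P ≡ count Q
count-cong {zero} _ = refl
count-cong {suc N} e = cong₂ _+_ (cong indicator (e zero)) (count-cong (e ∘ suc))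

count-mono : ∀ {N} {P Q : Fin N → Bool} → (∀ x → P x ≡ true → Q x ≡ true) → count P ≤ count Q
count-mono {zero} _ = z≤n
count-mono {suc N} {P} {Q} P⊆Q = +-mono-≤ (indicator-mono (P⊆Q zero)) (count-mono (P⊆Q ∘ suc))
  where
  indicator-mono : ∀ {a b} → (a ≡ true → b ≡ true) → indicator a ≤ indicator b
  indicator-mono {false} _ = z≤n
  indicator-mono {true} f rewrite f refl = ≤-refl

count-all : ∀ N → count {N} (λ _ → true) ≡ N
count-all zero = refl
count-all (suc N) = cong suc (count-all N)


opaque
  unfolding _∩_ _∖_ _─_

  count-split : ∀ {N} (P Q : Fin N → Bool) → count P ≡ count (P ∩ Q) + count (P ∖ Q)
  count-split {zero} P Q = refl
  count-split {suc N} P Q = begin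
    indicator (P zero) + count (P ∘ suc)
      ≡⟨ cong₂ _+_ (indicator-split (P zero) (Q zero)) (count-split (P ∘ suc) (Q ∘ suc)) ⟩
    (indicator ((P ∩ Q) zero) + indicator ((P ∖ Q) zero)) + (count ((P ∩ Q) ∘ suc) + count ((P ∖ Q) ∘ suc))
      ≡⟨ +-exchange (indicator ((P ∩ Q) zero)) _ _ _ ⟩
    count (P ∩ Q) + count (P ∖ Q) ∎
    where
    open ≡-Reasoning
    indicator-split : ∀ a b → indicator a ≡ indicator (a ∧ b) + indicator (a ∧ not b)
    indicator-split true true = refl
    indicator-split true false = refl
    indicator-split false _ = refl
    +-exchange : ∀ a b c d → (a + b) + (c + d) ≡ (a + c) + (b + d)
    +-exchange = solve-∀

  count-remove : ∀ {N} (P : Fin N → Bool) (x : Fin N) → count P ≡ indicator (P x) + count (P ─ x)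
  count-remove {suc N} P zero = begin
    indicator (P zero) + count (P ∘ suc)
      ≡⟨ cong (indicator (P zero) +_) (count-cong (λ y → sym (∧-identityʳ (P (suc y))))) ⟩
    indicator (P zero) + (0 + count ((P ─ zero) ∘ suc))
      ≡⟨ cong (λ b → indicator (P zero) + (indicator b + count ((P ─ zero) ∘ suc))) (sym (∧-zeroʳ (P zero))) ⟩
    indicator (P zero) + count (P ─ zero) ∎
    where open ≡-Reasoning
  count-remove {suc N} P (suc x) = begin
    indicator (P zero) + count (P ∘ suc)
      ≡⟨ cong (indicator (P zero) +_) (count-remove (P ∘ suc) x) ⟩
    indicator (P zero) + (indicator (P (suc x)) + count ((P ∘ suc) ─ x))
      ≡⟨ +-swap (indicator (P zero)) (indicator (P (suc x))) (count ((P ∘ suc) ─ x)) ⟩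
    indicator (P (suc x)) + (indicator (P zero) + count ((P ∘ suc) ─ x))
      ≡⟨ cong (λ b → indicator (P (suc x)) + (indicator b + count ((P ∘ suc) ─ x))) (sym (∧-identityʳ (P zero))) ⟩
    indicator (P (suc x)) + count (P ─ suc x) ∎
    where
    open ≡-Reasoning
    +-swap : ∀ a b c → a + (b + c) ≡ b + (a + c)
    +-swap = solve-∀

  ─-elim : ∀ {N} {P : Fin N → Bool} {x y} → (P ─ x) y ≡ true → P y ≡ true × x ≢ y
  ─-elim e = ∧-elimˡ e , neqᵇ-≢ (∧-elimʳ e)

  ─-intro : ∀ {N} {P : Fin N → Bool} {x y} → P y ≡ true → x ≢ y → (P ─ x) y ≡ true
  ─-intro py x≢y = ∧-intro py (≢-neqᵇ x≢y)

  ─-absent : ∀ {N} {P : Fin N → Bool} {x y} → P y ≡ false → (P ─ x) y ≡ false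
  ─-absent py rewrite py = refl


  ∩-elim : ∀ {N} {P Q : Fin N → Bool} {x} → (P ∩ Q) x ≡ true → P x ≡ true × Q x ≡ true
  ∩-elim e = ∧-elimˡ e , ∧-elimʳ e

  ∩-intro : ∀ {N} {P Q : Fin N → Bool} {x} → P x ≡ true → Q x ≡ true → (P ∩ Q) x ≡ true
  ∩-intro = ∧-intro

  ∖-elim : ∀ {N} {P Q : Fin N → Bool} {x} → (P ∖ Q) x ≡ true → P x ≡ true × Q x ≡ false
  ∖-elim e = ∧-elimˡ e , not-elim (∧-elimʳ e)

  ∖-intro : ∀ {N} {P Q : Fin N → Bool} {x} → P x ≡ true → Q x ≡ false → (P ∖ Q) x ≡ true
  ∖-intro px qx = ∧-intro px (not-intro qx)

  ∩-comm : ∀ {N} (P Q : Fin N → Bool) x → (P ∩ Q) x ≡ (Q ∩ P) x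
  ∩-comm P Q x = ∧-comm (P x) (Q x)


─-elim₂ : ∀ {N} {P : Fin N → Bool} {x y w} → (P ─ x ─ y) w ≡ true → P w ≡ true × x ≢ w × y ≢ w
─-elim₂ e = let (e' , y≢w) = ─-elim e ; (pw , x≢w) = ─-elim e' in pw , x≢w , y≢w

─-elim₃ : ∀ {N} {P : Fin N → Bool} {x y z w} → (P ─ x ─ y ─ z) w ≡ true → P w ≡ true × x ≢ w × y ≢ w × z ≢ w
─-elim₃ e = let (e' , z≢w) = ─-elim e ; (pw , x≢w , y≢w) = ─-elim₂ e' in pw , x≢w , y≢w , z≢w

count-witness : ∀ {N} {k} (P : Fin N → Bool) → suc k ≤ count P → ∃ λ x → P x ≡ true
count-witness {suc N} P pos with P zero in e
... | true = zero , e
... | false = let (x , px) = count-witness (P ∘ suc) pos in suc x , px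

remove-present : ∀ {N} (P : Fin N → Bool) (x : Fin N) → P x ≡ true → count P ≡ suc (count (P ─ x))
remove-present P x px = trans (count-remove P x) (cong (λ b → indicator b + count (P ─ x)) px)

remove-absent : ∀ {N k} (P : Fin N → Bool) (x : Fin N) → P x ≡ false → k ≤ count P → k ≤ count (P ─ x)
remove-absent P x px le = ≤-trans le (≤-reflexive (trans (count-remove P x) (cong (λ b → indicator b + count (P ─ x)) px)))

remove-≥ : ∀ {N k} (P : Fin N → Bool) (x : Fin N) → suc k ≤ count P → k ≤ count (P ─ x)
remove-≥ P x le = ≤-pred (≤-trans le (≤-trans (≤-reflexive (count-remove P x)) (+-monoˡ-≤ _ (indicator≤1 (P x)))))

count-two : ∀ {N} (P : Fin N → Bool) {x y} → P x ≡ true → P y ≡ true → x ≢ y → 2 ≤ count P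
count-two P {x} {y} px py x≢y = ≤-trans (s≤s (count-witness⁻¹ (P ─ x) (─-intro py x≢y))) (≤-reflexive (sym (remove-present P x px)))
  where
  count-witness⁻¹ : ∀ {N} (Q : Fin N → Bool) {z} → Q z ≡ true → 1 ≤ count Q
  count-witness⁻¹ Q {z} qz = ≤-trans (s≤s z≤n) (≤-reflexive (sym (remove-present Q z qz)))

count-≤1 : ∀ {N} (P : Fin N → Bool) x → (∀ w → P w ≡ true → w ≡ x) → count P ≤ 1
count-≤1 {N} P x only = ≤-trans (≤-reflexive (count-remove P x)) (+-mono-≤ (indicator≤1 (P x)) (≤-reflexive nothing-else))
  where
  nothing-else : count (P ─ x) ≡ 0
  nothing-else = n≤0⇒n≡0 (≤-trans (count-mono {Q = λ _ → false} absurd) (≤-reflexive (count-none N)))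
    where
    absurd : ∀ w → (P ─ x) w ≡ true → false ≡ true
    absurd w e with ─-elim e
    ... | pw , x≢w = ⊥-elim (x≢w (sym (only w pw)))
    count-none : ∀ M → count {M} (λ _ → false) ≡ 0
    count-none zero = refl
    count-none (suc M) = count-none M

count-∨ : ∀ {N} (P Q : Fin N → Bool) → count (λ w → P w ∨ Q w) ≤ count P + count Q
count-∨ {zero} P Q = z≤n
count-∨ {suc N} P Q = ≤-trans (+-monoʳ-≤ (indicator (P zero ∨ Q zero)) (count-∨ (P ∘ suc) (Q ∘ suc)))
  (≤-trans (+-monoˡ-≤ _ (indicator-∨ (P zero) (Q zero))) (≤-reflexive (exchange (indicator (P zero)) (indicator (Q zero)) (count (P ∘ suc)) (count (Q ∘ suc)))))
  where
  indicator-∨ : ∀ a b → indicator (a ∨ b) ≤ indicator a + indicator b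
  indicator-∨ true _ = s≤s z≤n
  indicator-∨ false _ = ≤-refl
  exchange : ∀ a b c d → (a + b) + (c + d) ≡ (a + c) + (b + d)
  exchange = solve-∀

common-member : ∀ {N} (P Q R : Fin N → Bool) → count R < count (P ∩ R) + count (Q ∩ R) →
  ∃ λ x → P x ≡ true × Q x ≡ true × R x ≡ true
common-member P Q R too-many = unpack (count-witness ((Q ∩ R) ∩ P) meet)
  where
  -- Q ∩ R splits by P; the part outside P lies in R ∖ P, whose size is |R| - |P ∩ R|.
  outside : count ((Q ∩ R) ∖ P) ≤ count (R ∖ P)
  outside = count-mono {P = (Q ∩ R) ∖ P} {Q = R ∖ P} (λ w e → let (qr , ¬p) = ∖-elim e in ∖-intro (proj₂ (∩-elim qr)) ¬p)
  R-split : count R ≡ count (P ∩ R) + count (R ∖ P)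
  R-split = trans (count-split R P) (cong (_+ count (R ∖ P)) (count-cong (λ w → ∩-comm R P w)))
  meet : 1 ≤ count ((Q ∩ R) ∩ P)
  meet = +-cancelʳ-≤ (count (R ∖ P)) 1 _ (+-cancelˡ-≤ (count (P ∩ R)) _ _ (begin
    count (P ∩ R) + (1 + count (R ∖ P))  ≡⟨ +-suc (count (P ∩ R)) (count (R ∖ P)) ⟩
    suc (count (P ∩ R) + count (R ∖ P))  ≡⟨ cong suc (sym R-split) ⟩
    suc (count R)                        ≤⟨ too-many ⟩
    count (P ∩ R) + count (Q ∩ R)        ≤⟨ +-monoʳ-≤ (count (P ∩ R)) (≤-trans (≤-reflexive (count-split (Q ∩ R) P)) (+-monoʳ-≤ _ outside)) ⟩
    count (P ∩ R) + (count ((Q ∩ R) ∩ P) + count (R ∖ P)) ∎))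
    where open ≤-Reasoning
  unpack : (∃ λ x → ((Q ∩ R) ∩ P) x ≡ true) → ∃ λ x → P x ≡ true × Q x ≡ true × R x ≡ true
  unpack (x , e) = let (qr , px) = ∩-elim e ; (qx , rx) = ∩-elim qr in x , px , qx , rx

pick : ∀ {N} k (P : Fin N → Bool) → k ≤ count P →
  Σ (Fin k → Fin N) λ h → Injective _≡_ _≡_ h × (∀ i → P (h i) ≡ true)
pick zero P _ = (λ ()) , (λ {}) , (λ ())
pick (suc k) P k<cnt with count-witness P k<cnt
... | x , px with pick k (P ─ x) (≤-pred (≤-trans k<cnt (≤-reflexive (remove-present P x px))))
... | g , g-inj , g∈ = h , h-inj , h∈
  where
  h : Fin (suc k) → _
  h zero = x
  h (suc i) = g i
  h-inj : Injective _≡_ _≡_ h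
  h-inj {zero} {zero} _ = refl
  h-inj {zero} {suc j} e = ⊥-elim (proj₂ (─-elim (g∈ j)) e)
  h-inj {suc i} {zero} e = ⊥-elim (proj₂ (─-elim (g∈ i)) (sym e))
  h-inj {suc i} {suc j} e = cong suc (g-inj e)
  h∈ : ∀ i → P (h i) ≡ true
  h∈ zero = px
  h∈ (suc i) = proj₁ (─-elim (g∈ i))

pigeonhole : ∀ {N k} (P : Fin N → Bool) (h : Fin k → Fin N) → Injective _≡_ _≡_ h → (∀ i → P (h i) ≡ true) → k ≤ count P
pigeonhole {k = zero} P h _ _ = z≤n
pigeonhole {k = suc k} P h h-inj h∈ = ≤-trans
  (s≤s (pigeonhole (P ─ h zero) (h ∘ suc) (fsuc-injective ∘ h-inj) (λ i → ─-intro (h∈ (suc i)) (zero≢suc ∘ h-inj))))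
  (≤-reflexive (sym (remove-present P (h zero) (h∈ zero))))
  where
  zero≢suc : ∀ {i : Fin k} → zero ≢ suc i
  zero≢suc ()

count-injection : ∀ {N} (P : Fin N → Bool) (ι : Fin N → ℕ) B →
  (∀ x y → P x ≡ true → P y ≡ true → ι x ≡ ι y → x ≡ y) → (∀ x → P x ≡ true → ι x < B) → count P ≤ B
count-injection P ι B ι-inj ι<B with pick (count P) P ≤-refl
... | h , h-inj , h∈ = ≤-trans (pigeonhole (λ _ → true) code code-inj (λ _ → refl)) (≤-reflexive (count-all B))
  where
  code : Fin (count P) → Fin B
  code i = fromℕ< (ι<B (h i) (h∈ i))
  code-inj : Injective _≡_ _≡_ code
  code-inj {i} {j} e = h-inj (ι-inj (h i) (h j) (h∈ i) (h∈ j)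
    (trans (sym (toℕ-fromℕ< _)) (trans (cong toℕ e) (toℕ-fromℕ< _))))

complement : ∀ {N} → Graph N → Graph N
complement G = record
  { adj = complAdj G
  ; sym = λ u v → cong₂ (λ b c → b ∧ not c) (neqᵇ-sym u v) (Graph.sym G u v)
  ; irrefl = λ v → cong (λ b → b ∧ not (adj G v v)) (neqᵇ-self v)
  }

degree : ∀ {N} → Graph N → Fin N → ℕ
degree G v = count (adj G v)

adj-≢ : ∀ {N} (G : Graph N) {u v} → adj G u v ≡ true → u ≢ v
adj-≢ G {u} e refl = true≢false e (irrefl G u)

-- Complementing twice gives back G (adjacent vertices are distinct).
complement-involutive : ∀ {N} (G : Graph N) v w → adj (complement (complement G)) v w ≡ adj G v w
complement-involutive G v w with neqᵇ v w in e | adj G v w in a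
... | true | true = refl
... | true | false = refl
... | false | false = refl
... | false | true = ⊥-elim (true≢false (≢-neqᵇ (adj-≢ G a)) e)

opaque
  unfolding _∩_ _∖_ _─_

  -- Every other vertex is a neighbour either in G or in its complement.
  degree-sum : ∀ {N} (G : Graph N) v → suc (degree G v + degree (complement G) v) ≡ N
  degree-sum {N} G v = begin
    suc (count (adj G v) + count (complAdj G v))
      ≡⟨ cong (λ d → suc (d + count (complAdj G v))) (count-cong adj-distinct) ⟩
    suc (count (neqᵇ v ∩ adj G v) + count (complAdj G v))
      ≡⟨ cong suc (sym (count-split (neqᵇ v) (adj G v))) ⟩
    suc (count (neqᵇ v))
      ≡⟨ sym (remove-present (λ _ → true) v refl) ⟩
    count {N} (λ _ → true)
      ≡⟨ count-all N ⟩
    N ∎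
    where
    open ≡-Reasoning
    adj-distinct : ∀ w → adj G v w ≡ (neqᵇ v w ∧ adj G v w)
    adj-distinct w with adj G v w in a
    ... | true rewrite ≢-neqᵇ (adj-≢ G a) = refl
    ... | false = sym (∧-zeroʳ (neqᵇ v w))

-- The index of the spoke that carries the pendant v_{n-2}.
branch : Fin 2 → ℕ → ℕ
branch zero n = n ∸ 4
branch (suc zero) n = n ∸ 3

data TreeLink (j : Fin 2) (n : ℕ) : ℕ → ℕ → Set where
  spoke    : ∀ i → suc i ≤ n ∸ 3 → TreeLink j n 0 (suc i)
  pendant₁ : TreeLink j n (branch j n) (n ∸ 2)
  pendant₂ : TreeLink j n (n ∸ 3) (n ∸ 1)

tree-shape : ∀ j n (u v : Fin n) →
  Tree j n u v ≡ (spokeᵇ u v ∨ edgeᵇ (branch j n) (n ∸ 2) u v ∨ edgeᵇ (n ∸ 3) (n ∸ 1) u v)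
tree-shape zero n u v = refl
tree-shape (suc zero) n u v = refl

Linked : Fin 2 → (n : ℕ) → Fin n → Fin n → Set
Linked j n u v = TreeLink j n (toℕ u) (toℕ v) ⊎ TreeLink j n (toℕ v) (toℕ u)

spoke-link : ∀ {j n} (u v : Fin n) → spokeᵇ u v ≡ true → Linked j n u v
spoke-link {n = n} u v s with toℕ u | toℕ v
... | zero  | suc i with ∨-elim s
...   | inj₁ le = inj₁ (spoke i (≤ᵇ-elim (suc i) (n ∸ 3) le))
...   | inj₂ ()
spoke-link {n = n} u v s | suc i | zero with ∨-elim s
...   | inj₁ ()
...   | inj₂ le = inj₂ (spoke i (≤ᵇ-elim (suc i) (n ∸ 3) le))

edge-link : ∀ {j n a b} (u v : Fin n) → TreeLink j n a b → edgeᵇ a b u v ≡ true → Linked j n u v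
edge-link {j} {n} u v l e with ∨-elim e
... | inj₁ uv = inj₁ (subst₂ (TreeLink j n) (sym (≡ᵇ-elim (∧-elimˡ uv))) (sym (≡ᵇ-elim (∧-elimʳ uv))) l)
... | inj₂ vu = inj₂ (subst₂ (TreeLink j n) (sym (≡ᵇ-elim (∧-elimʳ vu))) (sym (≡ᵇ-elim (∧-elimˡ vu))) l)

tree-link : ∀ j n (u v : Fin n) → Tree j n u v ≡ true → Linked j n u v
tree-link j n u v e with ∨-elim (trans (sym (tree-shape j n u v)) e)
... | inj₁ s = spoke-link u v s
... | inj₂ p with ∨-elim p
...   | inj₁ p₁ = edge-link u v pendant₁ p₁
...   | inj₂ p₂ = edge-link u v pendant₂ p₂

-- Vertex sequences.  An embedding of T_n^j is described by the sequence of
-- images of v_0, v_1, ...; only its first n entries matter.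

InjectiveOn : ∀ {A : Set} → ℕ → (ℕ → A) → Set
InjectiveOn r g = ∀ i i' → i < r → i' < r → g i ≡ g i' → i ≡ i'

-- P holds for the first r entries of g.  (A record, so that P and g can be inferred.)
record Below {A : Set} (r : ℕ) (P : A → Set) (g : ℕ → A) : Set where
  constructor below
  field at : ∀ i → i < r → P (g i)
open Below

below-nil : ∀ {A : Set} {P : A → Set} {g} → Below 0 P g
below-nil = below λ _ ()

_◂_ : ∀ {A : Set} → A → (ℕ → A) → ℕ → A
(x ◂ g) zero = x
(x ◂ g) (suc i) = g i

_⊕_ : ∀ {A : Set} {k} → (Fin k → A) → (ℕ → A) → ℕ → A
_⊕_ {k = zero} h e = e
_⊕_ {k = suc k} h e = h zero ◂ ((h ∘ suc) ⊕ e)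

infixr 5 _◂_ _⊕_

below-◂ : ∀ {A : Set} {P : A → Set} {x g r} → P x → Below r P g → Below (suc r) P (x ◂ g)
below-◂ {P = P} {x} {g} {r} px pg = below at′
  where
  at′ : ∀ i → i < suc r → P ((x ◂ g) i)
  at′ zero _ = px
  at′ (suc i) (s≤s i<r) = at pg i i<r

◂-injective : ∀ {A : Set} {x : A} {g r} → InjectiveOn r g → Below r (x ≢_) g → InjectiveOn (suc r) (x ◂ g)
◂-injective g-inj fresh zero zero _ _ _ = refl
◂-injective g-inj fresh zero (suc i') _ (s≤s i'<r) e = ⊥-elim (at fresh i' i'<r e)
◂-injective g-inj fresh (suc i) zero (s≤s i<r) _ e = ⊥-elim (at fresh i i<r (sym e))
◂-injective g-inj fresh (suc i) (suc i') (s≤s i<r) (s≤s i'<r) e = cong suc (g-inj i i' i<r i'<r e)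

⊕-block : ∀ {A : Set} {k} (h : Fin k → A) e (j : Fin k) → (h ⊕ e) (toℕ j) ≡ h j
⊕-block h e zero = refl
⊕-block h e (suc j) = ⊕-block (h ∘ suc) e j

⊕-rest : ∀ {A : Set} {k} (h : Fin k → A) e t → (h ⊕ e) (t + k) ≡ e t
⊕-rest {k = zero} h e t = cong e (+-identityʳ t)
⊕-rest {k = suc k} h e t rewrite +-suc t k = ⊕-rest (h ∘ suc) e t

⊕-index : ∀ k i → (Σ (Fin k) λ j → toℕ j ≡ i) ⊎ (Σ ℕ λ t → i ≡ t + k)
⊕-index k i with i <? k
... | yes i<k = inj₁ (fromℕ< i<k , toℕ-fromℕ< i<k)
... | no i≮k = inj₂ (i ∸ k , sym (m∸n+n≡m (≮⇒≥ i≮k)))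

below-⊕ : ∀ {A : Set} {P : A → Set} {k r} {h : Fin k → A} {e} → (∀ j → P (h j)) → Below r P e → Below (r + k) P (h ⊕ e)
below-⊕ {P = P} {k} {r} {h} {e} ph pe = below at′
  where
  at′ : ∀ i → i < r + k → P ((h ⊕ e) i)
  at′ i i<r+k with ⊕-index k i
  ... | inj₁ (j , refl) = subst P (sym (⊕-block h e j)) (ph j)
  ... | inj₂ (t , refl) = subst P (sym (⊕-rest h e t)) (at pe t (+-cancelʳ-< k t r i<r+k))

⊕-injective : ∀ {A : Set} {k r} {h : Fin k → A} {e} → Injective _≡_ _≡_ h → InjectiveOn r e →
  (∀ j → Below r (h j ≢_) e) → InjectiveOn (r + k) (h ⊕ e)
⊕-injective {k = k} {r} {h} {e} h-inj e-inj disjoint i i' i<r+k i'<r+k eq with ⊕-index k i | ⊕-index k i'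
... | inj₁ (j , refl) | inj₁ (j' , refl) =
  cong toℕ (h-inj (trans (sym (⊕-block h e j)) (trans eq (⊕-block h e j'))))
... | inj₁ (j , refl) | inj₂ (t' , refl) =
  ⊥-elim (at (disjoint j) t' (+-cancelʳ-< k t' r i'<r+k) (trans (sym (⊕-block h e j)) (trans eq (⊕-rest h e t'))))
... | inj₂ (t , refl) | inj₁ (j' , refl) =
  ⊥-elim (at (disjoint j') t (+-cancelʳ-< k t r i<r+k) (sym (trans (sym (⊕-rest h e t)) (trans eq (⊕-block h e j')))))
... | inj₂ (t , refl) | inj₂ (t' , refl) =
  cong (_+ k) (e-inj t t' (+-cancelʳ-< k t r i<r+k) (+-cancelʳ-< k t' r i'<r+k)
    (trans (sym (⊕-rest h e t)) (trans eq (⊕-rest h e t'))))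

tree-embedding : ∀ {N} (G : Graph N) j n (g : ℕ → Fin N) → InjectiveOn n g →
  (∀ a b → TreeLink j n a b → adj G (g a) (g b) ≡ true) → Tree j n ⊆G adj G
tree-embedding G j n g g-inj g-links = g ∘ toℕ , (λ {u} {v} e → toℕ-injective (g-inj _ _ (toℕ<n u) (toℕ<n v) e)) , edges
  where
  edges : ∀ u v → Tree j n u v ≡ true → adj G (g (toℕ u)) (g (toℕ v)) ≡ true
  edges u v e with tree-link j n u v e
  ... | inj₁ l = g-links _ _ l
  ... | inj₂ l = trans (Graph.sym G _ _) (g-links _ _ l)

module Configurations {N : ℕ} (G : Graph N) where

  Γ : Fin N → Fin N → Bool
  Γ = adj G

  -- T_n^2 laid out as: centre c, the spokes h, then y carrying the pendants a and b.
  module T2-layout {n₀ c y a b} (cy : Γ c y ≡ true) (ya : Γ y a ≡ true) (yb : Γ y b ≡ true)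
    (c≢a : c ≢ a) (c≢b : c ≢ b) (a≢b : a ≢ b) (h : Fin (4 + n₀) → Fin N) (h-inj : Injective _≡_ _≡_ h)
    (h∈ : ∀ j → (Γ c ─ y ─ a ─ b) (h j) ≡ true) where

    tail : ℕ → Fin N
    tail = y ◂ a ◂ b ◂ (λ _ → c)

    g : ℕ → Fin N
    g = c ◂ h ⊕ tail

    spoke-facts : ∀ j → Γ c (h j) ≡ true × y ≢ h j × a ≢ h j × b ≢ h j
    spoke-facts j = ─-elim₃ (h∈ j)

    tail-inj : InjectiveOn 3 tail
    tail-inj = ◂-injective (◂-injective (◂-injective (λ _ _ ()) below-nil) (below-◂ a≢b below-nil))
      (below-◂ (adj-≢ G ya) (below-◂ (adj-≢ G yb) below-nil))

    spokes-off-tail : ∀ j → Below 3 (h j ≢_) tail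
    spokes-off-tail j = let (_ , y≢ , a≢ , b≢) = spoke-facts j in
      below-◂ (≢-sym y≢) (below-◂ (≢-sym a≢) (below-◂ (≢-sym b≢) below-nil))

    g-inj : InjectiveOn (8 + n₀) g
    g-inj = ◂-injective (⊕-injective h-inj tail-inj spokes-off-tail)
      (below-⊕ (λ j → adj-≢ G (proj₁ (spoke-facts j))) (below-◂ (adj-≢ G cy) (below-◂ c≢a (below-◂ c≢b below-nil))))

    centre-sees : Below (5 + n₀) (λ v → Γ c v ≡ true) (h ⊕ tail)
    centre-sees = below-⊕ (λ j → proj₁ (spoke-facts j)) (below-◂ cy below-nil)

    g-links : ∀ i i' → TreeLink (suc zero) (8 + n₀) i i' → Γ (g i) (g i') ≡ true
    g-links _ _ (spoke i i<) = at centre-sees i i<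
    g-links _ _ pendant₁ = subst₂ (λ p q → Γ p q ≡ true) (sym (⊕-rest h tail 0)) (sym (⊕-rest h tail 1)) ya
    g-links _ _ pendant₂ = subst₂ (λ p q → Γ p q ≡ true) (sym (⊕-rest h tail 0)) (sym (⊕-rest h tail 2)) yb

    embedding : Tree (suc zero) (8 + n₀) ⊆G Γ
    embedding = tree-embedding G (suc zero) (8 + n₀) g g-inj g-links

  T2-config : ∀ n₀ {c y a b} → Γ c y ≡ true → Γ y a ≡ true → Γ y b ≡ true →
    c ≢ a → c ≢ b → a ≢ b → 4 + n₀ ≤ count (Γ c ─ y ─ a ─ b) → Tree (suc zero) (8 + n₀) ⊆G Γ
  T2-config n₀ {c} {y} {a} {b} cy ya yb c≢a c≢b a≢b enough =
    let (h , h-inj , h∈) = pick (4 + n₀) (Γ c ─ y ─ a ─ b) enough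
    in T2-layout.embedding cy ya yb c≢a c≢b a≢b h h-inj h∈

  -- T_n^1 laid out as: centre c, the spokes h, then y₁ and y₂ carrying the pendants a and b.
  module T1-layout {n₀ c y₁ a y₂ b} (cy₁ : Γ c y₁ ≡ true) (y₁a : Γ y₁ a ≡ true) (cy₂ : Γ c y₂ ≡ true)
    (y₂b : Γ y₂ b ≡ true) (c≢a : c ≢ a) (c≢b : c ≢ b) (y₁≢y₂ : y₁ ≢ y₂) (y₁≢b : y₁ ≢ b) (y₂≢a : y₂ ≢ a)
    (a≢b : a ≢ b) (h : Fin (3 + n₀) → Fin N) (h-inj : Injective _≡_ _≡_ h)
    (h∈ : ∀ j → (Γ c ─ y₁ ─ a ─ y₂ ─ b) (h j) ≡ true) where

    tail : ℕ → Fin N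
    tail = y₁ ◂ y₂ ◂ a ◂ b ◂ (λ _ → c)

    g : ℕ → Fin N
    g = c ◂ h ⊕ tail

    spoke-facts : ∀ j → Γ c (h j) ≡ true × y₁ ≢ h j × a ≢ h j × y₂ ≢ h j × b ≢ h j
    spoke-facts j = let (e , b≢) = ─-elim (h∈ j) ; (cj , y₁≢ , a≢ , y₂≢) = ─-elim₃ e in cj , y₁≢ , a≢ , y₂≢ , b≢

    tail-inj : InjectiveOn 4 tail
    tail-inj = ◂-injective (◂-injective (◂-injective (◂-injective (λ _ _ ()) below-nil) (below-◂ a≢b below-nil))
      (below-◂ y₂≢a (below-◂ (adj-≢ G y₂b) below-nil)))
      (below-◂ y₁≢y₂ (below-◂ (adj-≢ G y₁a) (below-◂ y₁≢b below-nil)))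

    spokes-off-tail : ∀ j → Below 4 (h j ≢_) tail
    spokes-off-tail j = let (_ , y₁≢ , a≢ , y₂≢ , b≢) = spoke-facts j in
      below-◂ (≢-sym y₁≢) (below-◂ (≢-sym y₂≢) (below-◂ (≢-sym a≢) (below-◂ (≢-sym b≢) below-nil)))

    g-inj : InjectiveOn (8 + n₀) g
    g-inj = ◂-injective (⊕-injective h-inj tail-inj spokes-off-tail)
      (below-⊕ (λ j → adj-≢ G (proj₁ (spoke-facts j)))
        (below-◂ (adj-≢ G cy₁) (below-◂ (adj-≢ G cy₂) (below-◂ c≢a (below-◂ c≢b below-nil)))))

    centre-sees : Below (5 + n₀) (λ v → Γ c v ≡ true) (h ⊕ tail)
    centre-sees = below-⊕ (λ j → proj₁ (spoke-facts j)) (below-◂ cy₁ (below-◂ cy₂ below-nil))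

    g-links : ∀ i i' → TreeLink zero (8 + n₀) i i' → Γ (g i) (g i') ≡ true
    g-links _ _ (spoke i i<) = at centre-sees i i<
    g-links _ _ pendant₁ = subst₂ (λ p q → Γ p q ≡ true) (sym (⊕-rest h tail 0)) (sym (⊕-rest h tail 2)) y₁a
    g-links _ _ pendant₂ = subst₂ (λ p q → Γ p q ≡ true) (sym (⊕-rest h tail 1)) (sym (⊕-rest h tail 3)) y₂b

    embedding : Tree zero (8 + n₀) ⊆G Γ
    embedding = tree-embedding G zero (8 + n₀) g g-inj g-links

  T1-config : ∀ n₀ {c y₁ a y₂ b} → Γ c y₁ ≡ true → Γ y₁ a ≡ true → Γ c y₂ ≡ true → Γ y₂ b ≡ true →
    c ≢ a → c ≢ b → y₁ ≢ y₂ → y₁ ≢ b → y₂ ≢ a → a ≢ b →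
    3 + n₀ ≤ count (Γ c ─ y₁ ─ a ─ y₂ ─ b) → Tree zero (8 + n₀) ⊆G Γ
  T1-config n₀ {c} {y₁} {a} {y₂} {b} cy₁ y₁a cy₂ y₂b c≢a c≢b y₁≢y₂ y₁≢b y₂≢a a≢b enough =
    let (h , h-inj , h∈) = pick (3 + n₀) (Γ c ─ y₁ ─ a ─ y₂ ─ b) enough
    in T1-layout.embedding cy₁ y₁a cy₂ y₂b c≢a c≢b y₁≢y₂ y₁≢b y₂≢a a≢b h h-inj h∈

≤-from-sum : ∀ {a b x y} → a + b ≡ x + y → y ≤ b → a ≤ x
≤-from-sum {a} {b} {x} {y} eq y≤b = +-cancelʳ-≤ b a x (≤-trans (≤-reflexive eq) (+-monoʳ-≤ x y≤b))

module DenseGraph {N : ℕ} (H : Graph N) (m₀ n₀ : ℕ) (m₀≤ : m₀ ≤ 2 + n₀)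
  (degree-total : ∀ v → degree H v + degree (complement H) v ≡ 8 + (m₀ + n₀))
  (few-non-neighbours : ∀ v → degree (complement H) v ≤ 3 + m₀) where

  open Configurations H

  Γᶜ : Fin N → Fin N → Bool
  Γᶜ = adj (complement H)

  HasT1 HasT2 : Set
  HasT1 = Tree zero (8 + n₀) ⊆G Γ
  HasT2 = Tree (suc zero) (8 + n₀) ⊆G Γ

  non-adjacent : ∀ {v w} → Γᶜ v w ≡ true → Γ v w ≡ false
  non-adjacent e = not-elim (∧-elimʳ e)

  non-neighbour : ∀ {v w} → v ≢ w → Γ v w ≡ false → Γᶜ v w ≡ true
  non-neighbour v≢w vw = ∧-intro (≢-neqᵇ v≢w) (not-intro vw)

  separated : ∀ {c y a} → Γ c y ≡ true → Γᶜ c a ≡ true → y ≢ a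
  separated cy ca refl = true≢false cy (non-adjacent ca)

  degree-lower : ∀ v → 5 + n₀ ≤ degree H v
  degree-lower v = ≤-from-sum (trans (arith m₀ n₀) (sym (degree-total v))) (few-non-neighbours v)
    where
    arith : ∀ m₀ n₀ → (5 + n₀) + (3 + m₀) ≡ 8 + (m₀ + n₀)
    arith = solve-∀

  codegree-lower : ∀ v {d e} → degree H v ≤ d → e + d ≡ 8 + (m₀ + n₀) → e ≤ degree (complement H) v
  codegree-lower v deg≤ eq = ≤-from-sum (trans eq (trans (sym (degree-total v)) (+-comm (degree H v) _))) deg≤

  neighbours-split : ∀ {c a} → Γᶜ c a ≡ true → degree H a ≤ count (Γ a ∩ Γ c) + count (Γ a ∩ Γᶜ c)
  neighbours-split {c} {a} ca = ≤-trans (≤-reflexive (count-split (Γ a) (Γ c))) (+-monoʳ-≤ _ (count-mono outside))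
    where
    outside : ∀ w → (Γ a ∖ Γ c) w ≡ true → (Γ a ∩ Γᶜ c) w ≡ true
    outside w e with ∖-elim e
    ... | aw , cw = ∩-intro aw (non-neighbour c≢w cw)
      where
      c≢w : c ≢ w
      c≢w refl = true≢false (trans (Graph.sym H c a) aw) (non-adjacent ca)

  few-others : ∀ {c a} → Γᶜ c a ≡ true → count (Γ a ∩ Γᶜ c) ≤ 2 + m₀
  few-others {c} {a} ca = ≤-trans (count-mono inside) (≤-pred (≤-trans (≤-reflexive (sym (remove-present (Γᶜ c) a ca))) (few-non-neighbours c)))
    where
    inside : ∀ w → (Γ a ∩ Γᶜ c) w ≡ true → (Γᶜ c ─ a) w ≡ true
    inside w e = let (aw , cw) = ∩-elim e in ─-intro cw (adj-≢ H aw)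

  -- Every non-neighbour of c has a neighbour in common with c (this uses m < n).
  common-neighbour : ∀ {c a} → Γᶜ c a ≡ true → ∃ λ y → Γ a y ≡ true × Γ c y ≡ true
  common-neighbour {c} {a} ca = let (y , e) = count-witness (Γ a ∩ Γ c) one-common in y , ∩-elim e
    where
    one-common : 1 ≤ count (Γ a ∩ Γ c)
    one-common = +-cancelʳ-≤ (2 + m₀) 1 _ (≤-trans (s≤s (s≤s (s≤s m₀≤)))
      (≤-trans (degree-lower a) (≤-trans (neighbours-split ca) (+-monoʳ-≤ _ (few-others ca)))))

  record Branch (c : Fin N) : Set where
    constructor mkBranch
    field
      y a  : Fin N
      cy   : Γ c y ≡ true
      ya   : Γ y a ≡ true
      c≢a  : c ≢ a
      room : 5 + n₀ ≤ count (Γ c ─ y ─ a)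

  -- A vertex of degree at least n-2 has a branch: through any neighbour if its
  -- degree is at least n-1, and towards a non-neighbour otherwise.
  branch-at : ∀ c → 6 + n₀ ≤ degree H c → Branch c
  branch-at c large with 7 + n₀ ≤? degree H c
  ... | yes larger =
    let (y , cy) = count-witness (Γ c) larger
        (a , e) = count-witness (Γ y ─ c) (remove-≥ (Γ y) c (degree-lower y))
        (ya , c≢a) = ─-elim e
    in mkBranch y a cy ya c≢a (remove-≥ _ a (remove-≥ (Γ c) y larger))
  ... | no not-larger =
    let (a , ca) = count-witness (Γᶜ c) (codegree-lower c {e = 2 + m₀} (≤-pred (≰⇒> not-larger)) (arith m₀ n₀))
        (y , ay , cy) = common-neighbour ca
    in mkBranch y a cy (trans (Graph.sym H y a) ay) (adj-≢ (complement H) ca)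
         (remove-absent _ a (─-absent (non-adjacent ca)) (remove-≥ (Γ c) y large))
    where
    arith : ∀ m₀ n₀ → (2 + m₀) + (6 + n₀) ≡ 8 + (m₀ + n₀)
    arith = solve-∀

  -- A branch completes to T_n^2 with a second pendant b at y ...
  T2-from-branch : ∀ {c} → Branch c → HasT2
  T2-from-branch {c} (mkBranch y a cy ya c≢a room) =
    let (b , e) = count-witness (Γ y ─ c ─ a) (remove-≥ _ a (remove-≥ (Γ y) c (degree-lower y)))
        (yb , c≢b , a≢b) = ─-elim₂ e
    in T2-config n₀ cy ya yb c≢a c≢b a≢b (remove-≥ _ b room)

  -- ... and to T_n^1 with a further spoke y₂ carrying a pendant b.
  T1-from-branch : ∀ {c} → Branch c → HasT1
  T1-from-branch {c} (mkBranch y a cy ya c≢a room) =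
    let (y₂ , e₂) = count-witness (Γ c ─ y ─ a) room
        (cy₂ , y≢y₂ , a≢y₂) = ─-elim₂ e₂
        (b , e) = count-witness (Γ y₂ ─ c ─ y ─ a) (remove-≥ _ a (remove-≥ _ y (remove-≥ (Γ y₂) c (degree-lower y₂))))
        (y₂b , c≢b , y≢b , a≢b) = ─-elim₃ e
    in T1-config n₀ cy ya cy₂ y₂b c≢a c≢b y≢y₂ y≢b (≢-sym a≢y₂) a≢b (remove-≥ _ b (remove-≥ _ y₂ room))

  -- From here on H is (n-3)-regular; c is any vertex.
  module Regular (regular : ∀ v → degree H v ≤ 5 + n₀) (c : Fin N) where

    many-non-neighbours : 3 + m₀ ≤ count (Γᶜ c)
    many-non-neighbours = codegree-lower c (regular c) (arith m₀ n₀)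
      where
      arith : ∀ m₀ n₀ → (3 + m₀) + (5 + n₀) ≡ 8 + (m₀ + n₀)
      arith = solve-∀

    two-non-neighbours : ∃ λ a₁ → ∃ λ a₂ → Γᶜ c a₁ ≡ true × Γᶜ c a₂ ≡ true × a₁ ≢ a₂
    two-non-neighbours =
      let (a₁ , ca₁) = count-witness (Γᶜ c) many-non-neighbours
          (a₂ , e) = count-witness (Γᶜ c ─ a₁) (remove-≥ _ a₁ many-non-neighbours)
          (ca₂ , a₁≢a₂) = ─-elim e
      in a₁ , a₂ , ca₁ , ca₂ , a₁≢a₂

    Fork : Set
    Fork = ∃ λ y → Γ c y ≡ true × 2 ≤ count (Γ y ∩ Γᶜ c)

    fork? : Dec Fork
    fork? = any? (λ y → (Γ c y ≟B true) ×-dec (2 ≤? count (Γ y ∩ Γᶜ c)))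

    -- A fork y with non-neighbours a₁, a₂ of c is T_n^2 centred at c.
    T2-from-fork : Fork → HasT2
    T2-from-fork (y , cy , two) =
      let (a₁ , e₁) = count-witness (Γ y ∩ Γᶜ c) two
          (ya₁ , ca₁) = ∩-elim e₁
          (a₂ , e₂) = count-witness (Γ y ∩ Γᶜ c ─ a₁) (remove-≥ _ a₁ two)
          (e₂′ , a₁≢a₂) = ─-elim e₂
          (ya₂ , ca₂) = ∩-elim e₂′
      in T2-config n₀ cy ya₁ ya₂ (adj-≢ (complement H) ca₁) (adj-≢ (complement H) ca₂) a₁≢a₂
           (remove-absent _ a₂ (─-absent (─-absent (non-adjacent ca₂)))
             (remove-absent _ a₁ (─-absent (non-adjacent ca₁)) (remove-≥ (Γ c) y (degree-lower c))))

    fork-free : ¬ Fork → ∀ {y a x} → Γ c y ≡ true → Γ y a ≡ true → Γᶜ c a ≡ true → Γᶜ c x ≡ true → a ≢ x → Γ y x ≡ false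
    fork-free no-fork {y} {a} {x} cy ya ca cx a≢x with Γ y x in yx
    ... | false = refl
    ... | true = ⊥-elim (no-fork (y , cy , count-two (Γ y ∩ Γᶜ c) (∩-intro ya ca) (∩-intro yx cx) a≢x))

    -- Without forks, a non-neighbour a of c either yields T_n^2 centred at a common
    -- neighbour y of a and c (when a sees two non-neighbours of c), or shares n-4 neighbours with c.
    no-fork-at : ¬ Fork → ∀ {a} → Γᶜ c a ≡ true → HasT2 ⊎ (4 + n₀ ≤ count (Γ a ∩ Γ c))
    no-fork-at no-fork {a} ca with 2 ≤? count (Γ a ∩ Γᶜ c)
    ... | yes two =
      let (y , ay , cy) = common-neighbour ca
          ya = trans (Graph.sym H y a) ay
          (a′ , e′) = count-witness (Γ a ∩ Γᶜ c) two
          (aa′ , ca′) = ∩-elim e′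
          (a″ , e″) = count-witness (Γ a ∩ Γᶜ c ─ a′) (remove-≥ _ a′ two)
          (e‴ , a′≢a″) = ─-elim e″
          (aa″ , ca″) = ∩-elim e‴
      in inj₁ (T2-config n₀ ya aa′ aa″ (separated cy ca′) (separated cy ca″) a′≢a″
           (remove-absent _ a″ (─-absent (─-absent (fork-free no-fork cy ya ca ca″ (adj-≢ H aa″))))
             (remove-absent _ a′ (─-absent (fork-free no-fork cy ya ca ca′ (adj-≢ H aa′)))
               (remove-≥ (Γ y) a (degree-lower y)))))
    ... | no not-two = inj₂ (+-cancelʳ-≤ 1 (4 + n₀) _ (≤-trans (≤-reflexive (+-comm (4 + n₀) 1))
      (≤-trans (degree-lower a) (≤-trans (neighbours-split ca) (+-monoʳ-≤ _ (≤-pred (≰⇒> not-two)))))))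

    -- Two non-neighbours of c that share n-4 neighbours with c each (inside the n-3
    -- neighbours of c) have a common neighbour there: a fork.
    shared-fork : ∀ {a₁ a₂} → Γᶜ c a₁ ≡ true → Γᶜ c a₂ ≡ true → a₁ ≢ a₂ →
      4 + n₀ ≤ count (Γ a₁ ∩ Γ c) → 4 + n₀ ≤ count (Γ a₂ ∩ Γ c) → Fork
    shared-fork {a₁} {a₂} ca₁ ca₂ a₁≢a₂ shared₁ shared₂ =
      let (y , a₁y , a₂y , cy) = common-member (Γ a₁) (Γ a₂) (Γ c) too-many
      in y , cy , count-two (Γ y ∩ Γᶜ c) (∩-intro (trans (Graph.sym H y a₁) a₁y) ca₁)
                                           (∩-intro (trans (Graph.sym H y a₂) a₂y) ca₂) a₁≢a₂
      where
      arith : ∀ n → (2 + n) + (6 + n) ≡ (4 + n) + (4 + n)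
      arith = solve-∀
      too-many : count (Γ c) < count (Γ a₁ ∩ Γ c) + count (Γ a₂ ∩ Γ c)
      too-many = ≤-trans (s≤s (regular c))
        (≤-trans (≤-trans (m≤n+m (6 + n₀) (2 + n₀)) (≤-reflexive (arith n₀))) (+-mono-≤ shared₁ shared₂))

    -- Without forks, two non-neighbours of c cannot both share n-4 neighbours with c,
    -- so one of them yields T_n^2.
    no-fork-T2 : ¬ Fork → HasT2
    no-fork-T2 no-fork =
      let (a₁ , a₂ , ca₁ , ca₂ , a₁≢a₂) = two-non-neighbours
      in resolve (no-fork-at no-fork ca₁) (no-fork-at no-fork ca₂)
           (λ shared₁ shared₂ → no-fork (shared-fork ca₁ ca₂ a₁≢a₂ shared₁ shared₂))
      where
      resolve : ∀ {A B : Set} → HasT2 ⊎ A → HasT2 ⊎ B → (A → B → ⊥) → HasT2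
      resolve (inj₁ t) _ _ = t
      resolve (inj₂ _) (inj₁ t) _ = t
      resolve (inj₂ x) (inj₂ y) absurd = ⊥-elim (absurd x y)

    T2-regular : HasT2
    T2-regular with fork?
    ... | yes fork = T2-from-fork fork
    ... | no no-fork = no-fork-T2 no-fork

    Matching : Set
    Matching = Σ (Fin N) λ y₁ → Σ (Fin N) λ a₁ → Σ (Fin N) λ y₂ → Σ (Fin N) λ a₂ →
      Γ c y₁ ≡ true × Γ y₁ a₁ ≡ true × Γ c y₂ ≡ true × Γ y₂ a₂ ≡ true ×
      Γᶜ c a₁ ≡ true × Γᶜ c a₂ ≡ true × y₁ ≢ y₂ × a₁ ≢ a₂

    matching? : Dec Matching
    matching? = any? λ y₁ → any? λ a₁ → any? λ y₂ → any? λ a₂ →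
      (Γ c y₁ ≟B true) ×-dec (Γ y₁ a₁ ≟B true) ×-dec (Γ c y₂ ≟B true) ×-dec (Γ y₂ a₂ ≟B true) ×-dec
      (Γᶜ c a₁ ≟B true) ×-dec (Γᶜ c a₂ ≟B true) ×-dec ¬? (y₁ ≟F y₂) ×-dec ¬? (a₁ ≟F a₂)

    -- A matching y₁a₁, y₂a₂ is T_n^1 centred at c.
    T1-from-matching : Matching → HasT1
    T1-from-matching (y₁ , a₁ , y₂ , a₂ , cy₁ , y₁a₁ , cy₂ , y₂a₂ , ca₁ , ca₂ , y₁≢y₂ , a₁≢a₂) =
      T1-config n₀ cy₁ y₁a₁ cy₂ y₂a₂ (adj-≢ (complement H) ca₁) (adj-≢ (complement H) ca₂) y₁≢y₂
        (separated cy₁ ca₂) (separated cy₂ ca₁) a₁≢a₂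
        (remove-absent _ a₂ (─-absent (─-absent (─-absent (non-adjacent ca₂))))
          (remove-≥ _ y₂ (remove-absent _ a₁ (─-absent (non-adjacent ca₁)) (remove-≥ (Γ c) y₁ (degree-lower c)))))

    -- Without a matching, take non-neighbours a₁ ≠ a₂ of c and a common neighbour y₁ of a₁ and c.
    -- Every non-neighbour of c is then adjacent to y₁, so y₁ has degree at least m-1; and a₂
    -- shares only y₁ with c, so it has degree at most m-2.  With (n-3)-regularity and m < n
    -- this is impossible.
    module NoMatching (no-match : ¬ Matching) {a₁ a₂ y₁} (ca₁ : Γᶜ c a₁ ≡ true) (ca₂ : Γᶜ c a₂ ≡ true)
      (a₁≢a₂ : a₁ ≢ a₂) (cy₁ : Γ c y₁ ≡ true) (y₁a₁ : Γ y₁ a₁ ≡ true) where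

      all-to-y₁ : ∀ a → Γᶜ c a ≡ true → Γ y₁ a ≡ true
      all-to-y₁ a ca with a ≟F a₁
      ... | yes refl = y₁a₁
      ... | no a≢a₁ with common-neighbour ca
      ...   | y , ay , cy with y ≟F y₁
      ...     | yes refl = trans (Graph.sym H y a) ay
      ...     | no y≢y₁ = ⊥-elim (no-match (y₁ , a₁ , y , a , cy₁ , y₁a₁ , cy , trans (Graph.sym H y a) ay ,
                                            ca₁ , ca , ≢-sym y≢y₁ , ≢-sym a≢a₁))

      y₁-large : 4 + m₀ ≤ degree H y₁
      y₁-large = ≤-trans (s≤s (≤-trans many-non-neighbours (count-mono inside)))
        (≤-reflexive (sym (remove-present (Γ y₁) c (trans (Graph.sym H y₁ c) cy₁))))
        where
        inside : ∀ a → Γᶜ c a ≡ true → (Γ y₁ ─ c) a ≡ true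
        inside a ca = ─-intro (all-to-y₁ a ca) (adj-≢ (complement H) ca)

      only-y₁ : count (Γ a₂ ∩ Γ c) ≤ 1
      only-y₁ = count-≤1 (Γ a₂ ∩ Γ c) y₁ λ w e → is-y₁ w (∩-elim e)
        where
        is-y₁ : ∀ w → Γ a₂ w ≡ true × Γ c w ≡ true → w ≡ y₁
        is-y₁ w (a₂w , cw) with w ≟F y₁
        ... | yes w≡y₁ = w≡y₁
        ... | no w≢y₁ = ⊥-elim (no-match (y₁ , a₁ , w , a₂ , cy₁ , y₁a₁ , cw , trans (Graph.sym H w a₂) a₂w ,
                                          ca₁ , ca₂ , ≢-sym w≢y₁ , a₁≢a₂))

      a₂-small : 5 + n₀ ≤ 3 + m₀
      a₂-small = ≤-trans (degree-lower a₂) (≤-trans (neighbours-split ca₂) (+-mono-≤ only-y₁ (few-others ca₂)))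

      impossible : ⊥
      impossible = <-irrefl refl (≤-trans y₁-large (≤-trans (regular y₁) a₂-small))

    no-matching : ¬ Matching → ⊥
    no-matching no-match =
      let (a₁ , a₂ , ca₁ , ca₂ , a₁≢a₂) = two-non-neighbours
          (y₁ , a₁y₁ , cy₁) = common-neighbour ca₁
      in NoMatching.impossible no-match ca₁ ca₂ a₁≢a₂ cy₁ (trans (Graph.sym H y₁ a₁) a₁y₁)

    T1-regular : HasT1
    T1-regular with matching?
    ... | yes match = T1-from-matching match
    ... | no no-match = ⊥-elim (no-matching no-match)

  -- Both trees occur in H: via a branch if some degree is at least n-2, by the
  -- regular analysis otherwise (c₀ is any vertex).
  contains-trees : Fin N → ∀ j → Tree j (8 + n₀) ⊆G Γ
  contains-trees c₀ j with any? (λ c → 6 + n₀ ≤? degree H c)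
  ... | yes (c , large) = from-branch j (branch-at c large)
    where
    from-branch : ∀ j → Branch c → Tree j (8 + n₀) ⊆G Γ
    from-branch zero = T1-from-branch
    from-branch (suc zero) = T2-from-branch
  ... | no none = regular-tree j
    where
    open Regular (λ v → ≤-pred (≰⇒> (λ large → none (v , large)))) c₀
    regular-tree : ∀ j → Tree j (8 + n₀) ⊆G Γ
    regular-tree zero = T1-regular
    regular-tree (suc zero) = T2-regular

star-at : ∀ {N} (G : Graph N) k v → k ≤ degree G v → star (suc k) ⊆G adj G
star-at {N} G k v enough = centre (pick k (adj G v) enough)
  where
  centre : (Σ (Fin k → Fin N) λ h → Injective _≡_ _≡_ h × (∀ i → adj G v (h i) ≡ true)) → star (suc k) ⊆G adj G
  centre (h , h-inj , h∈) = f , f-inj , f-edges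
    where
    f : Fin (suc k) → Fin N
    f zero = v
    f (suc i) = h i
    f-inj : Injective _≡_ _≡_ f
    f-inj {zero} {zero} _ = refl
    f-inj {zero} {suc i} e = ⊥-elim (adj-≢ G (h∈ i) e)
    f-inj {suc i} {zero} e = ⊥-elim (adj-≢ G (h∈ i) (sym e))
    f-inj {suc i} {suc i'} e = cong suc (h-inj e)
    f-edges : ∀ u w → star (suc k) u w ≡ true → adj G (f u) (f w) ≡ true
    f-edges zero (suc i) _ = h∈ i
    f-edges (suc i) zero _ = trans (Graph.sym G (h i) v) (h∈ i)

upper-bound : ∀ m₀ n₀ → m₀ ≤ 2 + n₀ → ∀ j → Arrows (star (5 + m₀)) (Tree j (8 + n₀)) (suc (m₀ + (8 + n₀)))
upper-bound m₀ n₀ m₀≤ j G = by-max-degree (any? (λ v → 4 + m₀ ≤? degree G v))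
  where
  by-max-degree : Dec (∃ λ v → 4 + m₀ ≤ degree G v) → (star (5 + m₀) ⊆G adj G) ⊎ (Tree j (8 + n₀) ⊆G complAdj G)
  by-max-degree (yes (v , large)) = inj₁ (star-at G (4 + m₀) v large)
  by-max-degree (no none) = inj₂ (DenseGraph.contains-trees (complement G) m₀ n₀ m₀≤ total sparse zero j)
    where
    arith : ∀ m₀ n₀ → m₀ + (8 + n₀) ≡ 8 + (m₀ + n₀)
    arith = solve-∀
    total : ∀ v → degree (complement G) v + degree (complement (complement G)) v ≡ 8 + (m₀ + n₀)
    total v = trans (suc-injective (degree-sum (complement G) v)) (arith m₀ n₀)
    sparse : ∀ v → degree (complement (complement G)) v ≤ 3 + m₀
    sparse v = ≤-trans (≤-reflexive (count-cong (complement-involutive G v))) (≤-pred (≰⇒> (λ large → none (v , large))))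

-- For 2k < M, C(M,k) joins a and w when w - a or a - w is
-- one of 1, ..., k modulo M.

module Circulant (M k : ℕ) (2k<M : k + k < M) where

  -- The distance from A forward to W around ℤ/M.
  offset : ℕ → ℕ → ℕ
  offset A W with A ≤? W
  ... | yes _ = W ∸ A
  ... | no _ = (W + M) ∸ A

  offset-spec : ∀ A W → A < M → (A ≤ W × A + offset A W ≡ W) ⊎ (W < A × offset A W + A ≡ W + M)
  offset-spec A W A<M with A ≤? W
  ... | yes A≤W = inj₁ (A≤W , m+[n∸m]≡n A≤W)
  ... | no A≰W = inj₂ (≰⇒> A≰W , m∸n+n≡m (≤-trans (<⇒≤ A<M) (m≤n+m M W)))

  offset-self : ∀ A → offset A A ≡ 0
  offset-self A with A ≤? A
  ... | yes _ = n∸n≡0 A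
  ... | no A≰A = ⊥-elim (A≰A ≤-refl)

  offset<M : ∀ {A W} → A < M → W < M → offset A W < M
  offset<M {A} {W} A<M W<M with offset-spec A W A<M
  ... | inj₁ (_ , e) = ≤-<-trans (m≤n+m (offset A W) A) (≤-<-trans (≤-reflexive e) W<M)
  ... | inj₂ (W<A , e) = +-cancelʳ-< A (offset A W) M
    (≤-trans (s≤s (≤-reflexive e)) (≤-trans (+-monoˡ-≤ M W<A) (≤-reflexive (+-comm A M))))

  offset-injectiveʳ : ∀ {A W₁ W₂} → A < M → W₁ < M → W₂ < M → offset A W₁ ≡ offset A W₂ → W₁ ≡ W₂
  offset-injectiveʳ {A} {W₁} {W₂} A<M W₁<M W₂<M eq with offset-spec A W₁ A<M | offset-spec A W₂ A<M
  ... | inj₁ (_ , e₁) | inj₁ (_ , e₂) = trans (sym e₁) (trans (cong (A +_) eq) e₂)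
  ... | inj₂ (_ , e₁) | inj₂ (_ , e₂) = +-cancelʳ-≡ M W₁ W₂ (trans (sym e₁) (trans (cong (_+ A) eq) e₂))
  ... | inj₁ (_ , e₁) | inj₂ (_ , e₂) = ⊥-elim (<⇒≱ W₁<M (≤-trans (m≤n+m M W₂)
          (≤-reflexive (trans (sym e₂) (trans (cong (_+ A) (sym eq)) (trans (+-comm (offset A W₁) A) e₁))))))
  ... | inj₂ (_ , e₁) | inj₁ (_ , e₂) = ⊥-elim (<⇒≱ W₂<M (≤-trans (m≤n+m M W₁)
          (≤-reflexive (trans (sym e₁) (trans (cong (_+ A) eq) (trans (+-comm (offset A W₂) A) e₂))))))

  rearrange₁ : ∀ o M a → o + (a + M) ≡ (a + o) + M
  rearrange₁ = solve-∀

  rearrange₂ : ∀ a o p → a + (o + p) ≡ p + (a + o)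
  rearrange₂ = solve-∀

  rearrange₃ : ∀ w o p → w + (o + p) ≡ o + (w + p)
  rearrange₃ = solve-∀

  offset-injectiveˡ : ∀ {A₁ A₂ W} → A₁ < M → A₂ < M → W < M → offset A₁ W ≡ offset A₂ W → A₁ ≡ A₂
  offset-injectiveˡ {A₁} {A₂} {W} A₁<M A₂<M W<M eq with offset-spec A₁ W A₁<M | offset-spec A₂ W A₂<M
  ... | inj₁ (_ , e₁) | inj₁ (_ , e₂) = +-cancelʳ-≡ (offset A₁ W) A₁ A₂ (trans e₁ (trans (sym e₂) (cong (A₂ +_) (sym eq))))
  ... | inj₂ (_ , e₁) | inj₂ (_ , e₂) = +-cancelˡ-≡ (offset A₁ W) A₁ A₂ (trans e₁ (trans (sym e₂) (cong (_+ A₂) (sym eq))))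
  ... | inj₁ (_ , e₁) | inj₂ (_ , e₂) = ⊥-elim (<⇒≱ A₂<M (≤-trans (m≤n+m M A₁)
          (≤-reflexive (+-cancelˡ-≡ (offset A₁ W) _ _ (begin
            offset A₁ W + (A₁ + M) ≡⟨ rearrange₁ (offset A₁ W) M A₁ ⟩
            (A₁ + offset A₁ W) + M ≡⟨ cong (_+ M) e₁ ⟩
            W + M                  ≡⟨ sym e₂ ⟩
            offset A₂ W + A₂       ≡⟨ cong (_+ A₂) (sym eq) ⟩
            offset A₁ W + A₂       ∎)))))
    where open ≡-Reasoning
  ... | inj₂ (_ , e₁) | inj₁ (_ , e₂) = ⊥-elim (<⇒≱ A₁<M (≤-trans (m≤n+m M A₂)
          (≤-reflexive (+-cancelˡ-≡ (offset A₂ W) _ _ (begin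
            offset A₂ W + (A₂ + M) ≡⟨ rearrange₁ (offset A₂ W) M A₂ ⟩
            (A₂ + offset A₂ W) + M ≡⟨ cong (_+ M) e₂ ⟩
            W + M                  ≡⟨ sym e₁ ⟩
            offset A₁ W + A₁       ≡⟨ cong (_+ A₁) eq ⟩
            offset A₂ W + A₁       ∎)))))
    where open ≡-Reasoning

  offset-round : ∀ {A W} → A < M → W < M → A ≢ W → offset A W + offset W A ≡ M
  offset-round {A} {W} A<M W<M A≢W with offset-spec A W A<M | offset-spec W A W<M
  ... | inj₁ (A≤W , _) | inj₁ (W≤A , _) = ⊥-elim (A≢W (≤-antisym A≤W W≤A))
  ... | inj₂ (W<A , _) | inj₂ (A<W , _) = ⊥-elim (<-asym W<A A<W)
  ... | inj₁ (_ , e₁) | inj₂ (_ , e₂) = +-cancelˡ-≡ A _ _ (begin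
    A + (offset A W + offset W A) ≡⟨ rearrange₂ A (offset A W) (offset W A) ⟩
    offset W A + (A + offset A W) ≡⟨ cong (offset W A +_) e₁ ⟩
    offset W A + W                ≡⟨ e₂ ⟩
    A + M                         ∎)
    where open ≡-Reasoning
  ... | inj₂ (_ , e₁) | inj₁ (_ , e₂) = +-cancelˡ-≡ W _ _ (begin
    W + (offset A W + offset W A) ≡⟨ rearrange₃ W (offset A W) (offset W A) ⟩
    offset A W + (W + offset W A) ≡⟨ cong (offset A W +_) e₂ ⟩
    offset A W + A                ≡⟨ e₁ ⟩
    W + M                         ∎)
    where open ≡-Reasoning

  short : ℕ → Bool
  short o = (1 ≤ᵇ o) ∧ (o ≤ᵇ k)

  short-elim : ∀ {o} → short o ≡ true → 1 ≤ o × o ≤ k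
  short-elim {o} e = ≤ᵇ-elim 1 o (∧-elimˡ e) , ≤ᵇ-elim o k (∧-elimʳ e)

  long : ∀ {o} → short o ≡ false → 1 ≤ o → k < o
  long {o} e 1≤o = ≤ᵇ-false o k (subst (λ b → b ∧ (o ≤ᵇ k) ≡ false) (≤ᵇ-intro 1≤o) e)

  -- Short offsets are coded injectively below k by their predecessor.
  short-code : ∀ {o} → short o ≡ true → pred o < k
  short-code {zero} ()
  short-code {suc o} e = proj₂ (short-elim e)

  short-code-injective : ∀ {o o'} → short o ≡ true → short o' ≡ true → pred o ≡ pred o' → o ≡ o'
  short-code-injective {suc o} {suc o'} _ _ eq = cong suc eq

  forward backward : Fin M → Fin M → Bool
  forward a w = short (offset (toℕ a) (toℕ w))
  backward a w = short (offset (toℕ w) (toℕ a))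

  circulant : Graph M
  circulant = record
    { adj = λ a w → forward a w ∨ backward a w
    ; sym = λ a w → ∨-comm (forward a w) (backward a w)
    ; irrefl = λ a → cong (λ o → short o ∨ short o) (offset-self (toℕ a))
    }

  forward-count : ∀ a → count (forward a) ≤ k
  forward-count a = count-injection (forward a) (λ w → pred (offset (toℕ a) (toℕ w))) k
    (λ x y fx fy eq → toℕ-injective (offset-injectiveʳ (toℕ<n a) (toℕ<n x) (toℕ<n y) (short-code-injective {offset (toℕ a) (toℕ x)} {offset (toℕ a) (toℕ y)} fx fy eq)))
    (λ x fx → short-code {offset (toℕ a) (toℕ x)} fx)

  backward-count : ∀ a → count (backward a) ≤ k
  backward-count a = count-injection (backward a) (λ w → pred (offset (toℕ w) (toℕ a))) k
    (λ x y bx by eq → toℕ-injective (offset-injectiveˡ (toℕ<n x) (toℕ<n y) (toℕ<n a) (short-code-injective {offset (toℕ x) (toℕ a)} {offset (toℕ y) (toℕ a)} bx by eq)))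
    (λ x bx → short-code {offset (toℕ x) (toℕ a)} bx)

  degree-circulant : ∀ a → degree circulant a ≤ k + k
  degree-circulant a = ≤-trans (count-∨ (forward a) (backward a)) (+-mono-≤ (forward-count a) (backward-count a))

  far : ∀ {a w} → adj (complement circulant) a w ≡ true → k < offset (toℕ a) (toℕ w) × offset (toℕ a) (toℕ w) + k < M
  far {a} {w} e = k<o , ≤-trans (+-monoʳ-< o k<o′) (≤-reflexive round)
    where
    A<M = toℕ<n a
    W<M = toℕ<n w
    o = offset (toℕ a) (toℕ w)
    o′ = offset (toℕ w) (toℕ a)
    A≢W : toℕ a ≢ toℕ w
    A≢W eq = neqᵇ-≢ (∧-elimˡ e) (toℕ-injective eq)
    round : o + o′ ≡ M
    round = offset-round A<M W<M A≢W
    positive : ∀ {x y} → x + y ≡ M → y < M → 1 ≤ x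
    positive {zero} refl y<M = ⊥-elim (<-irrefl refl y<M)
    positive {suc x} _ _ = s≤s z≤n
    not-near : forward a w ∨ backward a w ≡ false
    not-near = not-elim (∧-elimʳ e)
    k<o : k < o
    k<o = long (∨-falseˡ not-near) (positive round (offset<M W<M A<M))
    k<o′ : k < o′
    k<o′ = long (∨-falseʳ not-near) (positive (trans (+-comm o′ o) round) (offset<M A<M W<M))

  codegree-circulant : ∀ a → degree (complement circulant) a ≤ M ∸ suc (k + k)
  codegree-circulant a = count-injection (adj (complement circulant) a) (λ w → offset (toℕ a) (toℕ w) ∸ suc k) (M ∸ suc (k + k))
    (λ x y ex ey eq → toℕ-injective (offset-injectiveʳ (toℕ<n a) (toℕ<n x) (toℕ<n y) (∸-cancelʳ-≡ (proj₁ (far {a} {x} ex)) (proj₁ (far {a} {y} ey)) eq)))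
    bound
    where
    bound : ∀ w → adj (complement circulant) a w ≡ true → offset (toℕ a) (toℕ w) ∸ suc k < M ∸ suc (k + k)
    bound w ew with far {a} {w} ew
    ... | k<o , o+k<M = m+n≤o⇒m≤o∸n (suc (offset (toℕ a) (toℕ w) ∸ suc k)) (≤-trans (≤-reflexive (begin
      suc (o ∸ suc k) + suc (k + k) ≡⟨ solve-suc (o ∸ suc k) k ⟩
      suc ((o ∸ suc k + suc k) + k) ≡⟨ cong (λ x → suc (x + k)) (m∸n+n≡m k<o) ⟩
      suc (o + k) ∎)) o+k<M)
      where
      open ≡-Reasoning
      o = offset (toℕ a) (toℕ w)
      solve-suc : ∀ t k → suc t + suc (k + k) ≡ suc ((t + suc k) + k)
      solve-suc = solve-∀

embedded-degree : ∀ {k N d} {H : Fin k → Fin k → Bool} {G : Fin N → Fin N → Bool} (e : H ⊆G G) u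
  (s : Fin d → Fin k) → Injective _≡_ _≡_ s → (∀ i → H u (s i) ≡ true) → d ≤ count (G (proj₁ e u))
embedded-degree {G = G} (f , f-inj , f-edges) u s s-inj s-adj =
  pigeonhole (G (f u)) (f ∘ s) (s-inj ∘ f-inj) (λ i → f-edges u (s i) (s-adj i))

tree-spoke : ∀ j n₀ (x : Fin (7 + n₀)) → toℕ x < 5 + n₀ → Tree j (8 + n₀) zero (suc x) ≡ true
tree-spoke zero n₀ x x< rewrite ≤ᵇ-intro x< = refl
tree-spoke (suc zero) n₀ x x< rewrite ≤ᵇ-intro x< = refl

-- A graph of maximum degree ≤ m-2 whose complement has maximum degree ≤ n-4 arrows
-- neither K_{1,m-1} (centre of degree m-1) nor T_n^j (centre of degree n-3).
no-arrow : ∀ m₀ n₀ j {M} (G : Graph M) → (∀ v → degree G v ≤ 3 + m₀) →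
  (∀ v → degree (complement G) v ≤ 4 + n₀) → ¬ Arrows (star (5 + m₀)) (Tree j (8 + n₀)) M
no-arrow m₀ n₀ j G sparse co-sparse arrows = refute (arrows G)
  where
  spokes : Fin (5 + n₀) → Fin (8 + n₀)
  spokes i = suc (inject≤ i (m≤n+m (5 + n₀) 2))
  spokes-injective : Injective _≡_ _≡_ spokes
  spokes-injective {i} {i'} e = inject≤-injective _ _ i i' (fsuc-injective e)
  spokes-adjacent : ∀ i → Tree j (8 + n₀) zero (spokes i) ≡ true
  spokes-adjacent i = tree-spoke j n₀ (inject≤ i _) (subst (_< 5 + n₀) (sym (toℕ-inject≤ i _)) (toℕ<n i))
  refute : (star (5 + m₀) ⊆G adj G) ⊎ (Tree j (8 + n₀) ⊆G complAdj G) → ⊥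
  refute (inj₁ e) = <-irrefl refl (≤-trans (embedded-degree {G = adj G} e zero suc fsuc-injective (λ _ → refl)) (sparse (proj₁ e zero)))
  refute (inj₂ e) = <-irrefl refl (≤-trans (embedded-degree {G = complAdj G} e zero spokes spokes-injective spokes-adjacent) (co-sparse (proj₁ e zero)))

-- Fewer than n vertices: the empty graph contains no edge, its complement too few vertices.
no-arrow-small : ∀ m₀ n₀ j M → M < 8 + n₀ → ¬ Arrows (star (5 + m₀)) (Tree j (8 + n₀)) M
no-arrow-small m₀ n₀ j M M<n arrows = refute (arrows empty)
  where
  empty : Graph M
  empty = record { adj = λ _ _ → false ; sym = λ _ _ → refl ; irrefl = λ _ → refl }
  refute : (star (5 + m₀) ⊆G adj empty) ⊎ (Tree j (8 + n₀) ⊆G complAdj empty) → ⊥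
  refute (inj₁ (f , _ , f-edges)) = true≢false (f-edges zero (suc zero) refl) refl
  refute (inj₂ (f , f-inj , _)) = <⇒≱ M<n (≤-trans (pigeonhole (λ _ → true) f f-inj (λ _ → refl)) (≤-reflexive (count-all M)))

circulant-no-arrow : ∀ m₀ n₀ j M k (2k<M : k + k < M) → k + k ≤ 3 + m₀ → M ≤ suc (k + k) + (4 + n₀) →
  ¬ Arrows (star (5 + m₀)) (Tree j (8 + n₀)) M
circulant-no-arrow m₀ n₀ j M k 2k<M 2k≤ M≤ = no-arrow m₀ n₀ j circulant
  (λ v → ≤-trans (degree-circulant v) 2k≤) (λ v → ≤-trans (codegree-circulant v) (m≤n+o⇒m∸n≤o M (suc (k + k)) M≤))
  where open Circulant M k 2k<M

co-circulant-no-arrow : ∀ m₀ n₀ j M k (2k<M : k + k < M) → k + k ≤ 4 + n₀ → M ≤ suc (k + k) + (3 + m₀) →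
  ¬ Arrows (star (5 + m₀)) (Tree j (8 + n₀)) M
co-circulant-no-arrow m₀ n₀ j M k 2k<M 2k≤ M≤ = no-arrow m₀ n₀ j (complement circulant)
  (λ v → ≤-trans (codegree-circulant v) (m≤n+o⇒m∸n≤o M (suc (k + k)) M≤))
  (λ v → ≤-trans (≤-reflexive (count-cong (complement-involutive circulant v))) (≤-trans (degree-circulant v) 2k≤))
  where open Circulant M k 2k<M

half : ∀ x → Σ ℕ λ t → (t + t ≡ x) ⊎ (suc (t + t) ≡ x)
half zero = 0 , inj₁ refl
half (suc x) with half x
... | t , inj₁ e = t , inj₂ (cong suc e)
... | t , inj₂ e = suc t , inj₁ (trans (cong suc (+-suc t t)) (cong suc e))

odd≢even : ∀ x q → suc (x + x) ≢ q * 2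
odd≢even zero (suc zero) ()
odd≢even (suc x) (suc q) e = odd≢even x q (suc-injective (suc-injective (trans (cong suc (sym (+-suc (suc x) x))) e)))

-- Arrowing is decidable: search all adjacency matrices and all vertex maps.

Searchable : (A : Set) → (A → A → Set) → Set₁
Searchable A _≈_ = ∀ (P : A → Set) → (∀ x → Dec (P x)) → (∀ {x y} → x ≈ y → P x → P y) → Dec (Σ A P)

Pointwise : ∀ {A : Set} {k} → (A → A → Set) → (Fin k → A) → (Fin k → A) → Set
Pointwise _≈_ f g = ∀ i → f i ≈ g i

search-Fin : ∀ {n} → Searchable (Fin n) _≡_
search-Fin P P? _ = any? P?

search-Bool : Searchable Bool _≡_
search-Bool P P? _ with P? true | P? false
... | yes p | _ = yes (true , p)
... | no _ | yes q = yes (false , q)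
... | no ¬p | no ¬q = no λ { (true , p) → ¬p p ; (false , q) → ¬q q }

-- Finite sequences over a searchable type are searchable, one entry at a time.
search-functions : ∀ k {A : Set} {_≈_ : A → A → Set} → (∀ x → x ≈ x) → Searchable A _≈_ →
  Searchable (Fin k → A) (Pointwise _≈_)
search-functions zero ≈-refl search P P? invariant with P? (λ ())
... | yes p = yes ((λ ()) , p)
... | no ¬p = no λ (f , pf) → ¬p (invariant (λ ()) pf)
search-functions (suc k) {A} {_≈_} ≈-refl search P P? invariant with search Extends Extends? extends-invariant
  where
  cons : A → (Fin k → A) → Fin (suc k) → A
  cons a g zero = a
  cons a g (suc i) = g i
  Extends : A → Set
  Extends a = Σ (Fin k → A) λ g → P (cons a g)
  Extends? : ∀ a → Dec (Extends a)
  Extends? a = search-functions k ≈-refl search (λ g → P (cons a g)) (λ g → P? (cons a g))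
    (λ g≈g' → invariant λ { zero → ≈-refl a ; (suc i) → g≈g' i })
  extends-invariant : ∀ {a a'} → a ≈ a' → Extends a → Extends a'
  extends-invariant a≈a' (g , p) = g , invariant (λ { zero → a≈a' ; (suc i) → ≈-refl (g i) }) p
... | yes (a , g , p) = yes (_ , p)
... | no ¬extends = no λ (f , pf) → ¬extends (f zero , (λ i → f (suc i)) ,
  invariant (λ { zero → ≈-refl (f zero) ; (suc i) → ≈-refl (f (suc i)) }) pf)

_⊆G?_ : ∀ {k n} (H : Fin k → Fin k → Bool) (G : Fin n → Fin n → Bool) → Dec (H ⊆G G)
_⊆G?_ {k} {n} H G with search-functions k (λ _ → refl) search-Fin Embeds Embeds? embeds-invariant
  where
  Embeds : (Fin k → Fin n) → Set
  Embeds f = (∀ x y → f x ≡ f y → x ≡ y) × (∀ u v → H u v ≡ true → G (f u) (f v) ≡ true)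
  Embeds? : ∀ f → Dec (Embeds f)
  Embeds? f = all? (λ x → all? (λ y → (f x ≟F f y) →-dec (x ≟F y)))
          ×-dec all? (λ u → all? (λ v → (H u v ≟B true) →-dec (G (f u) (f v) ≟B true)))
  embeds-invariant : ∀ {f g} → Pointwise _≡_ f g → Embeds f → Embeds g
  embeds-invariant {f} {g} f≗g (f-inj , f-edges) =
    (λ x y e → f-inj x y (trans (f≗g x) (trans e (sym (f≗g y))))) ,
    (λ u v e → subst₂ (λ p q → G p q ≡ true) (f≗g u) (f≗g v) (f-edges u v e))
... | yes (f , f-inj , f-edges) = yes (f , (λ {x} {y} → f-inj x y) , f-edges)
... | no ¬embeds = no λ (f , f-inj , f-edges) → ¬embeds (f , (λ x y → f-inj {x} {y}) , f-edges)

-- Whether N vertices arrow (H₁, H₂) is decidable: search for a counterexample graph.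
arrows? : ∀ {k₁ k₂} (H₁ : Fin k₁ → Fin k₁ → Bool) (H₂ : Fin k₂ → Fin k₂ → Bool) N → Dec (Arrows H₁ H₂ N)
arrows? H₁ H₂ N with search-functions N (λ _ _ → refl) (search-functions N (λ _ → refl) search-Bool) Bad Bad? bad-invariant
  where
  Matrix : Set
  Matrix = Fin N → Fin N → Bool
  co : Matrix → Matrix
  co a u v = neqᵇ u v ∧ not (a u v)
  Bad : Matrix → Set
  Bad a = (∀ u v → a u v ≡ a v u) × (∀ v → a v v ≡ false) × ¬ ((H₁ ⊆G a) ⊎ (H₂ ⊆G co a))
  Bad? : ∀ a → Dec (Bad a)
  Bad? a = all? (λ u → all? (λ v → a u v ≟B a v u)) ×-dec all? (λ v → a v v ≟B false)
       ×-dec ¬? ((H₁ ⊆G? a) ⊎-dec (H₂ ⊆G? co a))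
  transport : ∀ {k} {H : Fin k → Fin k → Bool} {a b : Matrix} → (∀ u v → a u v ≡ b u v) → H ⊆G a → H ⊆G b
  transport a≗b (f , f-inj , f-edges) = f , f-inj , λ u v e → trans (sym (a≗b (f u) (f v))) (f-edges u v e)
  bad-invariant : ∀ {a b} → (∀ u v → a u v ≡ b u v) → Bad a → Bad b
  bad-invariant {a} {b} a≗b (a-sym , a-irr , a-good) =
    (λ u v → trans (sym (a≗b u v)) (trans (a-sym u v) (a≗b v u))) ,
    (λ v → trans (sym (a≗b v v)) (a-irr v)) ,
    λ { (inj₁ e) → a-good (inj₁ (transport (λ u v → sym (a≗b u v)) e))
      ; (inj₂ e) → a-good (inj₂ (transport (λ u v → cong (λ z → neqᵇ u v ∧ not z) (sym (a≗b u v))) e)) }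
... | yes (a , a-sym , a-irr , a-good) = no λ arrows → a-good (arrows (record { adj = a ; sym = a-sym ; irrefl = a-irr }))
... | no ¬bad = yes λ G → decide G ((H₁ ⊆G? adj G) ⊎-dec (H₂ ⊆G? complAdj G))
  where
  decide : (G : Graph N) → Dec ((H₁ ⊆G adj G) ⊎ (H₂ ⊆G complAdj G)) → (H₁ ⊆G adj G) ⊎ (H₂ ⊆G complAdj G)
  decide G (yes good) = good
  decide G (no ¬good) = ⊥-elim (¬bad (adj G , Graph.sym G , irrefl G , ¬good))

module Bounds (m₀ n₀ : ℕ) (m₀≤ : m₀ ≤ 2 + n₀) (j : Fin 2) where

  Arrow : ℕ → Set
  Arrow = Arrows (star (5 + m₀)) (Tree j (8 + n₀))

  N : ℕ
  N = m₀ + (8 + n₀)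

  upper : Arrow (suc N)
  upper = upper-bound m₀ n₀ m₀≤ j

  -- Below m+n-5: the empty graph below n, otherwise C(M,k) with 2k ∈ {m-3, m-2}.
  too-few : ∀ M → M < N → ¬ Arrow M
  too-few M M<N with M <? 8 + n₀
  ... | yes small = no-arrow-small m₀ n₀ j M small
  ... | no ¬small = with-half (half (3 + m₀))
    where
    arith : ∀ m₀ n₀ → m₀ + (8 + n₀) ≡ suc ((3 + m₀) + (4 + n₀))
    arith = solve-∀
    with-half : (Σ ℕ λ k → (k + k ≡ 3 + m₀) ⊎ (suc (k + k) ≡ 3 + m₀)) → ¬ Arrow M
    with-half (k , parity) = circulant-no-arrow m₀ n₀ j M k 2k<M 2k≤ M≤
      where
      2k≤ : k + k ≤ 3 + m₀
      2k≤ = [ ≤-reflexive , (λ e → ≤-trans (n≤1+n _) (≤-reflexive e)) ] parity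
      2k<M : k + k < M
      2k<M = ≤-<-trans 2k≤ (≤-<-trans (+-monoʳ-≤ 3 m₀≤) (≤-trans (m≤n+m (6 + n₀) 2) (≮⇒≥ ¬small)))
      m-2≤2k+1 : 3 + m₀ ≤ suc (k + k)
      m-2≤2k+1 = [ (λ e → ≤-trans (≤-reflexive (sym e)) (n≤1+n _)) , (λ e → ≤-reflexive (sym e)) ] parity
      M≤ : M ≤ suc (k + k) + (4 + n₀)
      M≤ = ≤-trans (≤-pred (≤-trans M<N (≤-reflexive (arith m₀ n₀)))) (+-monoˡ-≤ (4 + n₀) m-2≤2k+1)

  -- At m+n-5 when mn is even: C(N,k) with 2k = m-2 if m is even, the complement of
  -- C(N,k) with 2k = n-4 if n is even.
  at-even : 2 ∣ (5 + m₀) * (8 + n₀) → ¬ Arrow N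
  at-even even with half m₀ | half n₀
  ... | t , inj₂ m₀-odd | _ = circulant-no-arrow m₀ n₀ j N (2 + t) 2k<N (≤-reflexive 2k) (≤-reflexive N≡)
    where
    2k : (2 + t) + (2 + t) ≡ 3 + m₀
    2k = trans (arith t) (cong (3 +_) m₀-odd)
      where
      arith : ∀ t → (2 + t) + (2 + t) ≡ 3 + suc (t + t)
      arith = solve-∀
    N≡ : N ≡ suc ((2 + t) + (2 + t)) + (4 + n₀)
    N≡ = trans (arith m₀ n₀) (cong (λ x → suc x + (4 + n₀)) (sym 2k))
      where
      arith : ∀ m₀ n₀ → m₀ + (8 + n₀) ≡ suc (3 + m₀) + (4 + n₀)
      arith = solve-∀
    2k<N : (2 + t) + (2 + t) < N
    2k<N = ≤-trans (s≤s (≤-reflexive 2k)) (≤-trans (≤-reflexive (+-comm 4 m₀)) (+-monoʳ-≤ m₀ (m≤m+n 4 (4 + n₀))))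
  ... | t , inj₁ m₀-even | s , inj₁ n₀-even = co-circulant-no-arrow m₀ n₀ j N (2 + s) 2k<N (≤-reflexive 2k) (≤-reflexive N≡)
    where
    2k : (2 + s) + (2 + s) ≡ 4 + n₀
    2k = trans (arith s) (cong (4 +_) n₀-even)
      where
      arith : ∀ s → (2 + s) + (2 + s) ≡ 4 + (s + s)
      arith = solve-∀
    N≡ : N ≡ suc ((2 + s) + (2 + s)) + (3 + m₀)
    N≡ = trans (arith m₀ n₀) (cong (λ x → suc x + (3 + m₀)) (sym 2k))
      where
      arith : ∀ m₀ n₀ → m₀ + (8 + n₀) ≡ suc (4 + n₀) + (3 + m₀)
      arith = solve-∀
    2k<N : (2 + s) + (2 + s) < N
    2k<N = ≤-trans (s≤s (≤-reflexive 2k)) (≤-trans (s≤s (m≤n+m (4 + n₀) 3)) (m≤n+m (8 + n₀) m₀))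
  ... | t , inj₁ m₀-even | s , inj₂ n₀-odd = ⊥-elim (odd-product even)
    where
    -- m and n are both odd, so mn is odd
    arith : ∀ t s → (5 + (t + t)) * (8 + suc (s + s)) ≡
      suc ((22 + 5 * s + 9 * t + 2 * t * s) + (22 + 5 * s + 9 * t + 2 * t * s))
    arith = solve-∀
    odd-product : 2 ∣ (5 + m₀) * (8 + n₀) → ⊥
    odd-product (divides q eq) =
      odd≢even (22 + 5 * s + 9 * t + 2 * t * s) q (trans (sym (arith t s)) (trans (cong₂ (λ a b → (5 + a) * (8 + b)) m₀-even n₀-odd) eq))

module _ {k₁ k₂} {H₁ : Fin k₁ → Fin k₁ → Bool} {H₂ : Fin k₂ → Fin k₂ → Bool} {N : ℕ}
  (below-N : ∀ M → M < N → ¬ Arrows H₁ H₂ M) where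

  ramsey-at : 1 ≤ N → Arrows H₁ H₂ N → RamseyNumber H₁ H₂ N
  ramsey-at 1≤N arrows = 1≤N , arrows , λ M _ → below-N M

  ramsey-after : Arrows H₁ H₂ (suc N) → ¬ Arrows H₁ H₂ N → RamseyNumber H₁ H₂ (suc N)
  ramsey-after arrows ¬arrows-N = s≤s z≤n , arrows , λ M _ M≤N →
    [ below-N M , (λ { refl → ¬arrows-N }) ] (m≤n⇒m<n∨m≡n (≤-pred M≤N))

theorem6p1 : (m n : ℕ) → 5 ≤ m → 8 ≤ n → m < n → (j : Fin 2) →
    (RamseyNumber (star m) (Tree j n) (m + n ∸ 4) ⊎ RamseyNumber (star m) (Tree j n) (m + n ∸ 5))
    × (2 ∣ m * n → RamseyNumber (star m) (Tree j n) (m + n ∸ 4))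
theorem6p1 _ _ (s≤s (s≤s (s≤s (s≤s (s≤s {n = m₀} z≤n)))))
  (s≤s (s≤s (s≤s (s≤s (s≤s (s≤s (s≤s (s≤s {n = n₀} z≤n))))))))
  (s≤s (s≤s (s≤s (s≤s (s≤s (s≤s m₀≤)))))) j =
  -- r is m+n-5 or m+n-4 according to whether m+n-5 vertices arrow; mn even rules out the first.
  either (arrows? (star (5 + m₀)) (Tree j (8 + n₀)) N) , λ even → ramsey-after too-few upper (at-even even)
  where
  open Bounds m₀ n₀ m₀≤ j
  either : Dec (Arrow N) → RamseyNumber (star (5 + m₀)) (Tree j (8 + n₀)) (suc N) ⊎ RamseyNumber (star (5 + m₀)) (Tree j (8 + n₀)) N
  either (yes arrows) = inj₂ (ramsey-at too-few (≤-trans (s≤s z≤n) (m≤n+m (8 + n₀) m₀)) arrows)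
  either (no ¬arrows) = inj₁ (ramsey-after too-few upper ¬arrows)
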